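{- In a nice graph $G$, any two induced subgraphs that are $\dagger$- or $\ddagger$-AWs and have the same set of three terminals $\{s,l,r\}$ have the same shallow terminal.
   Context: Graphs are finite, simple, undirected. A minimal forbidden set is $X\subseteq V(G)$ with $G[X]$ not an interval graph but every proper subset inducing an interval graph; $G$ is prereduced if it has no minimal forbidden set of at most $10$ vertices. A $\dagger$-AW $(s:c:l,B,r)$, $B=\{b_1,\dots,b_d\}$, $d\ge 3$, $b_0=l$, $b_{d+1}=r$: vertices $s,c,b_0,\dots,b_{d+1}$ with edges exactly $b_ib_{i+1}$ $(0\le i\le d)$, $cs$, $cb_i$ $(1\le i\le d)$. A $\ddagger$-AW $(s:c_1,c_2:l,B,r)$, $d\ge 2$: vertices $s,c_1,c_2,b_0,\dots,b_{d+1}$ with edges exactly $b_ib_{i+1}$, $c_1c_2$, $c_1s$, $c_2s$, $c_1l$, $c_2r$, $c_jb_i$ ($j=1,2$, $1\le i\le d$). Its terminals are $s,l,r$, and $s$ is its shallow terminal. A shallow terminal of $G$ is the shallow terminal of some induced $\dagger$- or $\ddagger$-AW of $G$. $G$ is nice if it is prereduced, chordal, and every shallow terminal of $G$ is simplicial (its neighborhood induces a clique). -}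

module Defs where

open import Data.Nat using (ℕ; zero; suc; _+_; _≤_)
open import Data.Fin using (Fin; toℕ; fromℕ) renaming (zero to fz; suc to fs)
open import Data.Fin.Subset using (Subset; _∈_; _⊂_; ∣_∣)
open import Data.Bool using (Bool; true; false)
open import Data.Product using (Σ; _×_; ∃; ∃-syntax)
open import Data.Sum using (_⊎_)
open import Relation.Nullary using (¬_)
open import Relation.Binary.PropositionalEquality using (_≡_; _≢_)
open import Function.Bundles using (_⇔_)
open import Function.Definitions using (Injective)

record Graph : Set where
  field
    n      : ℕ
    adj    : Fin n → Fin n → Bool
    sym    : ∀ u v → adj u v ≡ adj v u
    irrefl : ∀ v → adj v v ≡ false

open Graph public

Vtx : Graph → Set
Vtx G = Fin (n G)

E : (G : Graph) → Vtx G → Vtx G → Set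
E G u v = adj G u v ≡ true

-- Interval graphs (closed intervals with natural-number endpoints;
-- for finite graphs this is the usual notion).

IsIntervalOn : (G : Graph) → Subset (n G) → Set
IsIntervalOn G X =
  Σ (Vtx G → ℕ) λ lft → Σ (Vtx G → ℕ) λ rgt →
    (∀ v → v ∈ X → lft v ≤ rgt v) ×
    (∀ u v → u ∈ X → v ∈ X → u ≢ v →
       E G u v ⇔ (lft u ≤ rgt v × lft v ≤ rgt u))

MinimalForbidden : (G : Graph) → Subset (n G) → Set
MinimalForbidden G X =
  ¬ IsIntervalOn G X × (∀ Y → Y ⊂ X → IsIntervalOn G Y)

Prereduced : Graph → Set
Prereduced G = ∀ X → ∣ X ∣ ≤ 10 → ¬ MinimalForbidden G X

CycConsec : (k : ℕ) → ℕ → ℕ → Set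
CycConsec k i j =
  suc i ≡ j ⊎ suc j ≡ i ⊎ (i ≡ 0 × suc j ≡ k) ⊎ (j ≡ 0 × suc i ≡ k)

IsCycle : (G : Graph) (m : ℕ) → (Fin (4 + m) → Vtx G) → Set
IsCycle G m c =
  Injective _≡_ _≡_ c ×
  (∀ (i j : Fin (4 + m)) → suc (toℕ i) ≡ toℕ j → E G (c i) (c j)) ×
  E G (c (fromℕ (3 + m))) (c fz)

Chordal : Graph → Set
Chordal G = ∀ m (c : Fin (4 + m) → Vtx G) → IsCycle G m c →
  ∃[ i ] ∃[ j ] (i ≢ j × ¬ CycConsec (4 + m) (toℕ i) (toℕ j) × E G (c i) (c j))

Simplicial : (G : Graph) → Vtx G → Set
Simplicial G s = ∀ u w → E G s u → E G s w → u ≢ w → E G u w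

-- †-AW (s:c:l,B,r), B = {b_1..b_d}, d ≥ 3.
-- Vertex indices: s = 0, c = 1, b_i = 2 + i  (0 ≤ i ≤ d+1), b_0 = l, b_{d+1} = r.
data DagE (d : ℕ) : ℕ → ℕ → Set where
  path : ∀ i → i ≤ d → DagE d (2 + i) (3 + i)
  cs   : DagE d 0 1
  cb   : ∀ i → 1 ≤ i → i ≤ d → DagE d 1 (2 + i)

-- ‡-AW (s:c₁,c₂:l,B,r), d ≥ 2.
-- Vertex indices: s = 0, c₁ = 1, c₂ = 2, b_i = 3 + i (0 ≤ i ≤ d+1).
data DDagE (d : ℕ) : ℕ → ℕ → Set where
  path : ∀ i → i ≤ d → DDagE d (3 + i) (4 + i)
  c₁c₂ : DDagE d 1 2
  c₁s  : DDagE d 0 1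
  c₂s  : DDagE d 0 2
  c₁l  : DDagE d 1 3
  c₂r  : DDagE d 2 (4 + d)
  c₁b  : ∀ i → 1 ≤ i → i ≤ d → DDagE d 1 (3 + i)
  c₂b  : ∀ i → 1 ≤ i → i ≤ d → DDagE d 2 (3 + i)

InducedCopy : (G : Graph) (k : ℕ) (P : ℕ → ℕ → Set) → (Fin k → Vtx G) → Set
InducedCopy G k P f =
  Injective _≡_ _≡_ f ×
  (∀ x y → x ≢ y → E G (f x) (f y) ⇔ (P (toℕ x) (toℕ y) ⊎ P (toℕ y) (toℕ x)))

DaggerAW : (G : Graph) → Vtx G → Vtx G → Vtx G → Set
DaggerAW G s l r =
  Σ ℕ λ d → 3 ≤ d × Σ (Fin (4 + d) → Vtx G) λ f →
    InducedCopy G (4 + d) (DagE d) f ×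
    f fz ≡ s × f (fs (fs fz)) ≡ l × f (fromℕ (3 + d)) ≡ r

DDaggerAW : (G : Graph) → Vtx G → Vtx G → Vtx G → Set
DDaggerAW G s l r =
  Σ ℕ λ d → 2 ≤ d × Σ (Fin (5 + d) → Vtx G) λ f →
    InducedCopy G (5 + d) (DDagE d) f ×
    f fz ≡ s × f (fs (fs (fs fz))) ≡ l × f (fromℕ (4 + d)) ≡ r

AW : (G : Graph) → Vtx G → Vtx G → Vtx G → Set
AW G s l r = DaggerAW G s l r ⊎ DDaggerAW G s l r

ShallowTerminal : (G : Graph) → Vtx G → Set
ShallowTerminal G s = ∃[ l ] ∃[ r ] AW G s l r

Nice : Graph → Set
Nice G = Prereduced G × Chordal G × (∀ s → ShallowTerminal G s → Simplicial G s)

In3 : {A : Set} → A → A → A → A → Set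
In3 x a b c = x ≡ a ⊎ x ≡ b ⊎ x ≡ c

-- Each AW with terminals s, l, r contains a path from s to l avoiding the
-- closed neighbourhood of r and one from s to r avoiding that of l, each
-- with at most two inner vertices (s c b₁ l and s c b_d r, resp. s c₁ l
-- and s c₂ r).  If a second AW on the same terminals had a different
-- shallow terminal, it would supply a third such path, from l to r avoiding
-- N[s].  Then s, l, r is an asteroidal triple of a set of at most nine
-- vertices, which is not interval; as G is prereduced, every set of at most
-- ten vertices is (not not) interval.
module Submission where

open import Defs hiding (sym)
open import Data.Bool using (true; false)
open import Data.Empty using (⊥; ⊥-elim)
open import Data.Fin using (Fin; toℕ; fromℕ; fromℕ<) renaming (zero to fz; suc to fs)
open import Data.Fin.Properties using (toℕ-fromℕ; toℕ-fromℕ<)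
open import Data.Fin.Subset using (Subset; _∈_; _⊂_; ∣_∣) renaming (⊥ to ∅)
open import Data.Fin.Subset.Induction using (⊂-wellFounded)
open import Data.Fin.Subset.Properties using (p⊂q⇒∣p∣<∣q∣; ∣⊥∣≡0)
open import Data.List using (List; []; _∷_; length)
open import Data.List.Membership.Propositional using () renaming (_∈_ to _∈ˡ_)
open import Data.List.Relation.Unary.All using (All; []; _∷_)
import Data.List.Relation.Unary.All as All
open import Data.List.Relation.Unary.Any using (here; there)
open import Data.Nat using (ℕ; zero; suc; _+_; _≤_; _<_; z≤n; s≤s; _≤?_)
open import Data.Nat.Properties
  using (≤-refl; ≤-reflexive; ≤-trans; <⇒≤; ≤⇒≯; <-≤-trans; ≤-<-trans; <-asym; ≰⇒>;
         n≤1+n; n<1+n; m<n⇒m<1+n; 1+n≰n)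
open import Data.Product using (Σ; _×_; _,_; proj₁; proj₂; map₁)
import Data.Product as Product
open import Data.Sum using (_⊎_; inj₁; inj₂)
import Data.Sum as Sum
open import Data.Vec using ([]; _∷_)
import Data.Vec as Vec
open import Function using (_∘_; _$_)
open import Function.Bundles using (_⇔_; Equivalence)
open import Induction.WellFounded using (Acc; acc)
open import Relation.Binary.PropositionalEquality using (_≡_; _≢_; refl; sym; trans; cong)
open import Relation.Nullary using (¬_; yes; no)

¬¬-→ : {A B : Set} → (A → ¬ ¬ B) → ¬ ¬ (A → B)
¬¬-→ f k = k (λ a → ⊥-elim (f a (λ b → k (λ _ → b))))

¬¬-∀-Subset : ∀ {m} {P : Subset m → Set} → (∀ Y → ¬ ¬ P Y) → ¬ ¬ (∀ Y → P Y)
¬¬-∀-Subset {zero} h k = h [] (λ p → k (λ { [] → p }))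
¬¬-∀-Subset {suc m} {P} h k =
  ¬¬-∀-Subset {P = P ∘ (true ∷_)} (h ∘ (true ∷_)) λ all-in →
  ¬¬-∀-Subset {P = P ∘ (false ∷_)} (h ∘ (false ∷_)) λ all-out →
  k (λ { (true ∷ Y) → all-in Y ; (false ∷ Y) → all-out Y })

insert : ∀ {m} → Fin m → Subset m → Subset m
insert fz     (_ ∷ p) = true ∷ p
insert (fs v) (b ∷ p) = b ∷ insert v p

∣insert∣≤ : ∀ {m} (v : Fin m) p → ∣ insert v p ∣ ≤ suc ∣ p ∣
∣insert∣≤ fz     (true ∷ p)  = n≤1+n _
∣insert∣≤ fz     (false ∷ p) = ≤-refl
∣insert∣≤ (fs v) (true ∷ p)  = s≤s (∣insert∣≤ v p)
∣insert∣≤ (fs v) (false ∷ p) = ∣insert∣≤ v p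

x∈insert-x : ∀ {m} (v : Fin m) p → v ∈ insert v p
x∈insert-x fz     (_ ∷ p) = Vec.here
x∈insert-x (fs v) (_ ∷ p) = Vec.there (x∈insert-x v p)

∈⇒∈insert : ∀ {m} {w : Fin m} v p → w ∈ p → w ∈ insert v p
∈⇒∈insert fz     (_ ∷ p) Vec.here          = Vec.here
∈⇒∈insert fz     (_ ∷ p) (Vec.there w∈p)   = Vec.there w∈p
∈⇒∈insert (fs v) (_ ∷ p) Vec.here          = Vec.here
∈⇒∈insert (fs v) (_ ∷ p) (Vec.there w∈p)   = Vec.there (∈⇒∈insert v p w∈p)

fromList : ∀ {m} → List (Fin m) → Subset m
fromList []       = ∅
fromList (v ∷ vs) = insert v (fromList vs)

∣fromList∣≤length : ∀ {m} (vs : List (Fin m)) → ∣ fromList vs ∣ ≤ length vs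
∣fromList∣≤length {m} []   = ≤-reflexive (∣⊥∣≡0 m)
∣fromList∣≤length (v ∷ vs) =
  ≤-trans (∣insert∣≤ v (fromList vs)) (s≤s (∣fromList∣≤length vs))

∈⇒∈fromList : ∀ {m} {v : Fin m} {vs} → v ∈ˡ vs → v ∈ fromList vs
∈⇒∈fromList {vs = w ∷ vs} (here refl)  = x∈insert-x w (fromList vs)
∈⇒∈fromList {vs = w ∷ vs} (there v∈vs) = ∈⇒∈insert w (fromList vs) (∈⇒∈fromList v∈vs)

module _ {G : Graph} where

  private
    variable
      X : Subset (n G)
      a b c s l r s′ l′ r′ x y z : Vtx G

  E-sym : E G x y → E G y x
  E-sym {x = x} {y = y} e = trans (Graph.sym G y x) e

  E-irrefl : E G x y → x ≢ y
  E-irrefl {x = x} e refl with trans (sym e) (irrefl G x)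
  ... | ()

  Avoids : Vtx G → Vtx G → Set
  Avoids z v = v ≢ z × ¬ E G v z

  data Walk (P : Vtx G → Set) : Vtx G → Vtx G → Set where
    [_]  : P x → Walk P x x
    step : P x → E G x y → Walk P y z → Walk P x z

  module _ {P : Vtx G → Set} where

    head : Walk P x y → P x
    head [ p ]        = p
    head (step p _ _) = p

    last : Walk P x y → P y
    last [ p ]        = p
    last (step _ _ w) = last w

    map : {Q : Vtx G → Set} → (∀ {v} → P v → Q v) → Walk P x y → Walk Q x y
    map f [ p ]        = [ f p ]
    map f (step p e w) = step (f p) e (map f w)

  AvoidingWalk : Subset (n G) → Vtx G → Vtx G → Vtx G → Set
  AvoidingWalk X z = Walk (λ v → v ∈ X × Avoids z v)

  AsteroidalTriple : Subset (n G) → Vtx G → Vtx G → Vtx G → Set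
  AsteroidalTriple X a b c =
    AvoidingWalk X c a b × AvoidingWalk X b a c × AvoidingWalk X a b c

  module IntervalModel
    {X : Subset (n G)} (lft rgt : Vtx G → ℕ)
    (valid : ∀ v → v ∈ X → lft v ≤ rgt v)
    (model : ∀ u v → u ∈ X → v ∈ X → u ≢ v → E G u v ⇔ (lft u ≤ rgt v × lft v ≤ rgt u))
    where

    infix 4 _≺_
    _≺_ : Vtx G → Vtx G → Set
    u ≺ v = rgt u < lft v

    ≺-trans : y ∈ X → x ≺ y → y ≺ z → x ≺ z
    ≺-trans {y = y} y∈X x≺y y≺z = <-≤-trans x≺y (≤-trans (valid y y∈X) (<⇒≤ y≺z))

    ≺-asym : x ∈ X → y ∈ X → x ≺ y → ¬ y ≺ x
    ≺-asym {x = x} {y = y} x∈X y∈X x≺y y≺x =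
      <-asym (≤-<-trans (valid x x∈X) x≺y) (≤-<-trans (valid y y∈X) y≺x)

    edge⇒¬≺ : x ∈ X → y ∈ X → E G x y → ¬ x ≺ y
    edge⇒¬≺ x∈X y∈X e =
      ≤⇒≯ (proj₂ (Equivalence.to (model _ _ x∈X y∈X (E-irrefl e)) e))

    avoids⇒≺⊎≻ : x ∈ X → y ∈ X → Avoids y x → x ≺ y ⊎ y ≺ x
    avoids⇒≺⊎≻ {x = x} {y = y} x∈X y∈X (x≢y , ¬e) with lft x ≤? rgt y | lft y ≤? rgt x
    ... | no lx≰ry  | _         = inj₂ (≰⇒> lx≰ry)
    ... | yes _     | no ly≰rx  = inj₁ (≰⇒> ly≰rx)
    ... | yes lx≤ry | yes ly≤rx =
      ⊥-elim (¬e (Equivalence.from (model _ _ x∈X y∈X x≢y) (lx≤ry , ly≤rx)))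

    walk-keeps-≺ : z ∈ X → AvoidingWalk X z x y → x ≺ z → y ≺ z
    walk-keeps-≺ z∈X [ _ ] x≺z = x≺z
    walk-keeps-≺ z∈X (step (x∈X , _) e w) x≺z with head w
    ... | y∈X , y-avoids with avoids⇒≺⊎≻ y∈X z∈X y-avoids
    ...   | inj₁ y≺z = walk-keeps-≺ z∈X w y≺z
    ...   | inj₂ z≺y = ⊥-elim (edge⇒¬≺ x∈X y∈X e (≺-trans z∈X x≺z z≺y))

    walk-keeps-≻ : z ∈ X → AvoidingWalk X z x y → z ≺ x → z ≺ y
    walk-keeps-≻ z∈X [ _ ] z≺x = z≺x
    walk-keeps-≻ z∈X (step (x∈X , _) e w) z≺x with head w
    ... | y∈X , y-avoids with avoids⇒≺⊎≻ y∈X z∈X y-avoids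
    ...   | inj₂ z≺y = walk-keeps-≻ z∈X w z≺y
    ...   | inj₁ y≺z = ⊥-elim (edge⇒¬≺ y∈X x∈X (E-sym e) (≺-trans z∈X y≺z z≺x))

    Between : Vtx G → Vtx G → Vtx G → Set
    Between x y z = (x ≺ y × y ≺ z) ⊎ (z ≺ y × y ≺ x)

    between-blocks : y ∈ X → Between x y z → ¬ AvoidingWalk X y x z
    between-blocks y∈X (inj₁ (x≺y , y≺z)) w =
      ≺-asym y∈X (proj₁ (last w)) y≺z (walk-keeps-≺ y∈X w x≺y)
    between-blocks y∈X (inj₂ (z≺y , y≺x)) w =
      ≺-asym (proj₁ (last w)) y∈X z≺y (walk-keeps-≻ y∈X w y≺x)

    one-lies-between :
      a ≺ b ⊎ b ≺ a → b ≺ c ⊎ c ≺ b → a ≺ c ⊎ c ≺ a →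
      Between a b c ⊎ Between b a c ⊎ Between a c b
    one-lies-between (inj₁ a≺b) (inj₁ b≺c) _          = inj₁ (inj₁ (a≺b , b≺c))
    one-lies-between (inj₁ a≺b) (inj₂ c≺b) (inj₁ a≺c) = inj₂ (inj₂ (inj₁ (a≺c , c≺b)))
    one-lies-between (inj₁ a≺b) (inj₂ c≺b) (inj₂ c≺a) = inj₂ (inj₁ (inj₂ (c≺a , a≺b)))
    one-lies-between (inj₂ b≺a) (inj₂ c≺b) _          = inj₁ (inj₂ (c≺b , b≺a))
    one-lies-between (inj₂ b≺a) (inj₁ b≺c) (inj₁ a≺c) = inj₂ (inj₁ (inj₁ (b≺a , a≺c)))
    one-lies-between (inj₂ b≺a) (inj₁ b≺c) (inj₂ c≺a) = inj₂ (inj₂ (inj₂ (b≺c , c≺a)))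

    ¬asteroidal : ¬ AsteroidalTriple X a b c
    ¬asteroidal {a = a} {b = b} {c = c} (wab , wac , wbc) =
      blocked (one-lies-between (avoids⇒≺⊎≻ a∈X b∈X (proj₂ (head wac)))
                                (avoids⇒≺⊎≻ b∈X c∈X (proj₂ (last wab)))
                                (avoids⇒≺⊎≻ a∈X c∈X (proj₂ (head wab))))
      where
      a∈X = proj₁ (head wab)
      b∈X = proj₁ (last wab)
      c∈X = proj₁ (last wac)
      blocked : Between a b c ⊎ Between b a c ⊎ Between a c b → ⊥
      blocked (inj₁ b-between)        = between-blocks b∈X b-between wac
      blocked (inj₂ (inj₁ a-between)) = between-blocks a∈X a-between wbc
      blocked (inj₂ (inj₂ c-between)) = between-blocks c∈X c-between wab

  asteroidal⇒¬interval : AsteroidalTriple X a b c → ¬ IsIntervalOn G X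
  asteroidal⇒¬interval triple (lft , rgt , valid , model) =
    IntervalModel.¬asteroidal lft rgt valid model triple

  -- Only doubly negated: a minimal non-interval subset cannot be found constructively.
  prereduced⇒¬¬interval : Prereduced G → ∣ X ∣ ≤ 10 → ¬ ¬ IsIntervalOn G X
  prereduced⇒¬¬interval {X = X} pre = go X (⊂-wellFounded X)
    where
    go : ∀ X → Acc _⊂_ X → ∣ X ∣ ≤ 10 → ¬ ¬ IsIntervalOn G X
    go X (acc rec) X≤10 ¬interval =
      ¬¬-∀-Subset (λ Y → ¬¬-→ λ Y⊂X →
          go Y (rec Y⊂X) (≤-trans (<⇒≤ (p⊂q⇒∣p∣<∣q∣ Y⊂X)) X≤10))
        (λ subsets-interval → pre X X≤10 (¬interval , subsets-interval))

  AvoidingWalkVia : Vtx G → Vtx G → Vtx G → Vtx G → Vtx G → Set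
  AvoidingWalkVia z x y u w = Walk (λ v → v ∈ˡ x ∷ y ∷ u ∷ w ∷ [] × Avoids z v) x y

  ShortAvoidingWalk : Vtx G → Vtx G → Vtx G → Set
  ShortAvoidingWalk z x y = Σ (Vtx G) λ u → Σ (Vtx G) λ w → AvoidingWalkVia z x y u w

  TerminalWalks : Vtx G → Vtx G → Vtx G → Set
  TerminalWalks s l r = ShortAvoidingWalk r s l × ShortAvoidingWalk l s r

  -- Indices are passed as equations since toℕ (fromℕ m) is stuck for variable m.
  module _ {k} {P : ℕ → ℕ → Set} {f : Fin k → Vtx G} (copy : InducedCopy G k P f) where

    copy-edge : ∀ x y {i j} → toℕ x ≡ i → toℕ y ≡ j → i ≢ j → P i j ⊎ P j i →
                E G (f x) (f y)
    copy-edge x y refl refl i≢j = Equivalence.from (proj₂ copy x y (i≢j ∘ cong toℕ))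

    copy-avoids : ∀ x y {i j} → toℕ x ≡ i → toℕ y ≡ j → i ≢ j → ¬ P i j → ¬ P j i →
                  Avoids (f y) (f x)
    copy-avoids x y refl refl i≢j ¬Pij ¬Pji =
      i≢j ∘ cong toℕ ∘ proj₁ copy ,
      Sum.[ ¬Pij , ¬Pji ] ∘ Equivalence.to (proj₂ copy x y (i≢j ∘ cong toℕ))

  dagger⇒terminalWalks : DaggerAW G s l r → TerminalWalks s l r
  dagger⇒terminalWalks (suc (suc (suc e)) , s≤s (s≤s (s≤s z≤n)) , f , copy , refl , refl , refl) =
    (f c₀ , f b₁ , s-c₀-b₁-l) , (f c₀ , f b_d , s-c₀-b_d-r)
    where
    d = 3 + e
    edge   = copy-edge {P = DagE d} copy
    avoids = copy-avoids {P = DagE d} copy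
    c₀ l₀ b₁ b_d r₀ : Fin (4 + d)
    c₀  = fs fz
    l₀  = fs (fs fz)
    b₁  = fs (fs (fs fz))
    b_d = fromℕ< (m<n⇒m<1+n (n<1+n (2 + d)))
    r₀  = fromℕ (3 + d)
    toℕ-b_d : toℕ b_d ≡ 2 + d
    toℕ-b_d = toℕ-fromℕ< (m<n⇒m<1+n (n<1+n (2 + d)))
    toℕ-r₀ : toℕ r₀ ≡ 3 + d
    toℕ-r₀ = toℕ-fromℕ (3 + d)
    s-c₀-b₁-l : AvoidingWalkVia (f r₀) (f fz) (f l₀) (f c₀) (f b₁)
    s-c₀-b₁-l =
      step (here refl , avoids fz r₀ refl toℕ-r₀ (λ ()) (λ ()) (λ ()))
           (edge fz c₀ refl refl (λ ()) (inj₁ cs)) $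
      step (there (there (here refl)) ,
            avoids c₀ r₀ refl toℕ-r₀ (λ ()) (λ { (cb _ _ i≤d) → 1+n≰n i≤d }) (λ ()))
           (edge c₀ b₁ refl refl (λ ()) (inj₁ (cb 1 ≤-refl (s≤s z≤n)))) $
      step (there (there (there (here refl))) ,
            avoids b₁ r₀ refl toℕ-r₀ (λ ()) (λ ()) (λ ()))
           (edge b₁ l₀ refl refl (λ ()) (inj₂ (path 0 z≤n)))
      [ there (here refl) , avoids l₀ r₀ refl toℕ-r₀ (λ ()) (λ ()) (λ ()) ]
    s-c₀-b_d-r : AvoidingWalkVia (f l₀) (f fz) (f r₀) (f c₀) (f b_d)
    s-c₀-b_d-r =
      step (here refl , avoids fz l₀ refl refl (λ ()) (λ ()) (λ ()))
           (edge fz c₀ refl refl (λ ()) (inj₁ cs)) $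
      step (there (there (here refl)) ,
            avoids c₀ l₀ refl refl (λ ()) (λ { (cb _ () _) }) (λ ()))
           (edge c₀ b_d refl toℕ-b_d (λ ()) (inj₁ (cb d (s≤s z≤n) ≤-refl))) $
      step (there (there (there (here refl))) ,
            avoids b_d l₀ toℕ-b_d refl (λ ()) (λ ()) (λ ()))
           (edge b_d r₀ toℕ-b_d toℕ-r₀ (λ ()) (inj₁ (path d ≤-refl)))
      [ there (here refl) , avoids r₀ l₀ toℕ-r₀ refl (λ ()) (λ ()) (λ ()) ]

  ddagger⇒terminalWalks : DDaggerAW G s l r → TerminalWalks s l r
  ddagger⇒terminalWalks (suc (suc e) , s≤s (s≤s z≤n) , f , copy , refl , refl , refl) =
    (f c₁ , f c₁ , s-c₁-l) , (f c₂ , f c₂ , s-c₂-r)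
    where
    d = 2 + e
    edge   = copy-edge {P = DDagE d} copy
    avoids = copy-avoids {P = DDagE d} copy
    c₁ c₂ l₀ r₀ : Fin (5 + d)
    c₁ = fs fz
    c₂ = fs (fs fz)
    l₀ = fs (fs (fs fz))
    r₀ = fromℕ (4 + d)
    toℕ-r₀ : toℕ r₀ ≡ 4 + d
    toℕ-r₀ = toℕ-fromℕ (4 + d)
    s-c₁-l : AvoidingWalkVia (f r₀) (f fz) (f l₀) (f c₁) (f c₁)
    s-c₁-l =
      step (here refl , avoids fz r₀ refl toℕ-r₀ (λ ()) (λ ()) (λ ()))
           (edge fz c₁ refl refl (λ ()) (inj₁ c₁s)) $
      step (there (there (here refl)) ,
            avoids c₁ r₀ refl toℕ-r₀ (λ ()) (λ { (c₁b _ _ i≤d) → 1+n≰n i≤d }) (λ ()))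
           (edge c₁ l₀ refl refl (λ ()) (inj₁ c₁l))
      [ there (here refl) , avoids l₀ r₀ refl toℕ-r₀ (λ ()) (λ ()) (λ ()) ]
    s-c₂-r : AvoidingWalkVia (f l₀) (f fz) (f r₀) (f c₂) (f c₂)
    s-c₂-r =
      step (here refl , avoids fz l₀ refl refl (λ ()) (λ ()) (λ ()))
           (edge fz c₂ refl refl (λ ()) (inj₁ c₂s)) $
      step (there (there (here refl)) ,
            avoids c₂ l₀ refl refl (λ ()) (λ { (c₂b _ () _) }) (λ ()))
           (edge c₂ r₀ refl toℕ-r₀ (λ ()) (inj₁ c₂r))
      [ there (here refl) , avoids r₀ l₀ toℕ-r₀ refl (λ ()) (λ ()) (λ ()) ]

  aw⇒terminalWalks : AW G s l r → TerminalWalks s l r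
  aw⇒terminalWalks = Sum.[ dagger⇒terminalWalks , ddagger⇒terminalWalks ]

  terminalWalks⇒distinct : TerminalWalks s l r → s ≢ l × s ≢ r × l ≢ r
  terminalWalks⇒distinct ((_ , _ , sl) , (_ , _ , sr)) =
    proj₁ (proj₂ (head sr)) , proj₁ (proj₂ (head sl)) , proj₁ (proj₂ (last sl))

  terminalWalks⇒¬shortWalk : Prereduced G → TerminalWalks s l r → ¬ ShortAvoidingWalk s l r
  terminalWalks⇒¬shortWalk {s = s} {l = l} {r = r} pre
    ((u₁ , u₂ , sl) , (w₁ , w₂ , sr)) (a , b , lr) =
    prereduced⇒¬¬interval pre (≤-trans (∣fromList∣≤length L) (n≤1+n 9))
      (asteroidal⇒¬interval ( widen (s∈ ∷ l∈ ∷ u₁∈ ∷ u₂∈ ∷ []) sl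
                            , widen (s∈ ∷ r∈ ∷ w₁∈ ∷ w₂∈ ∷ []) sr
                            , widen (l∈ ∷ r∈ ∷ a∈ ∷ b∈ ∷ []) lr ))
    where
    L : List (Vtx G)
    L = s ∷ l ∷ r ∷ u₁ ∷ u₂ ∷ w₁ ∷ w₂ ∷ a ∷ b ∷ []
    s∈  = here refl
    l∈  = there (here refl)
    r∈  = there (there (here refl))
    u₁∈ = there (there (there (here refl)))
    u₂∈ = there (there (there (there (here refl))))
    w₁∈ = there (there (there (there (there (here refl)))))
    w₂∈ = there (there (there (there (there (there (here refl))))))
    a∈  = there (there (there (there (there (there (there (here refl)))))))
    b∈  = there (there (there (there (there (there (there (there (here refl))))))))
    widen : ∀ {vs} → All (_∈ˡ L) vs →
            Walk (λ v → v ∈ˡ vs × Avoids z v) x y → AvoidingWalk (fromList L) z x y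
    widen vs⊆L = map (map₁ (∈⇒∈fromList ∘ All.lookup vs⊆L))

  shallow≢left : Prereduced G → TerminalWalks s l r → TerminalWalks s′ l′ r′ →
                 s′ ≡ l → In3 l′ s l r → In3 r′ s l r → ⊥
  shallow≢left pre walks walks′ refl l′∈ r′∈ with terminalWalks⇒distinct walks′
  shallow≢left pre walks walks′ refl (inj₁ refl) (inj₂ (inj₂ refl)) | _ =
    terminalWalks⇒¬shortWalk pre walks (proj₂ walks′)
  shallow≢left pre walks walks′ refl (inj₂ (inj₂ refl)) (inj₁ refl) | _ =
    terminalWalks⇒¬shortWalk pre walks (proj₁ walks′)
  shallow≢left pre walks walks′ refl (inj₁ refl) (inj₁ refl) | _ , _ , l′≢r′ = l′≢r′ refl
  shallow≢left pre walks walks′ refl (inj₂ (inj₁ refl)) _ | s′≢l′ , _ = s′≢l′ refl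
  shallow≢left pre walks walks′ refl _ (inj₂ (inj₁ refl)) | _ , s′≢r′ , _ = s′≢r′ refl
  shallow≢left pre walks walks′ refl (inj₂ (inj₂ refl)) (inj₂ (inj₂ refl)) | _ , _ , l′≢r′ =
    l′≢r′ refl

proposition8p1 : (G : Graph) → Nice G →
    (s l r s′ l′ r′ : Vtx G) → AW G s l r → AW G s′ l′ r′ →
    (∀ x → In3 x s l r ⇔ In3 x s′ l′ r′) →
    s ≡ s′
proposition8p1 G (pre , _) s l r s′ l′ r′ aw aw′ same = shallow (terminal s′ (inj₁ refl))
  where
  terminal : ∀ x → In3 x s′ l′ r′ → In3 x s l r
  terminal x = Equivalence.from (same x)
  walks  = aw⇒terminalWalks {G = G} aw
  walks′ = aw⇒terminalWalks {G = G} aw′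
  l′∈ = terminal l′ (inj₂ (inj₁ refl))
  r′∈ = terminal r′ (inj₂ (inj₂ refl))
  shallow : In3 s′ s l r → s ≡ s′
  shallow (inj₁ s′≡s)        = sym s′≡s
  shallow (inj₂ (inj₁ s′≡l)) = ⊥-elim (shallow≢left pre walks walks′ s′≡l l′∈ r′∈)
  shallow (inj₂ (inj₂ s′≡r)) =
    ⊥-elim (shallow≢left pre (Product.swap walks) walks′ s′≡r
              (Sum.map₂ Sum.swap l′∈) (Sum.map₂ Sum.swap r′∈))
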